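{- 1. If $N$ is a CBN surface context, then $N^{n}$ is a surface context of the Distant Bang Calculus. 2. If $S$ is a surface context of the Distant Bang Calculus and $G$ is a CBN full context such that $G^{n}=S$, then $G$ is a CBN surface context.
   Context: Distant Bang Calculus terms: $t,u ::= x \mid t\,u \mid \lambda x.t \mid !t \mid \mathrm{der}(t) \mid t[x\backslash u]$. Contexts have exactly one hole $\square$. Bang surface contexts: $S ::= \square \mid S\,t \mid t\,S \mid \lambda x.S \mid \mathrm{der}(S) \mid S[x\backslash t] \mid t[x\backslash S]$ (hole not under a $!$). CBN terms: $t,u ::= x \mid \lambda x.t \mid t\,u \mid t[x\backslash u]$; CBN full contexts $G ::= \square \mid G\,t \mid t\,G \mid \lambda x.G \mid G[x\backslash t] \mid t[x\backslash G]$; CBN surface contexts $N ::= \square \mid N\,t \mid \lambda x.N \mid N[x\backslash t]$. CBN embedding $(\cdot)^n$: $x^n=x$, $(\lambda x.t)^n=\lambda x.t^n$, $(t\,u)^n=t^n\,!u^n$, $(t[x\backslash u])^n=t^n[x\backslash !u^n]$; on contexts by the same clauses with $\square^n=\square$ (e.g. $(G\,t)^n=G^n\,!t^n$, $(t\,G)^n=t^n\,!G^n$, $(t[x\backslash G])^n=t^n[x\backslash !G^n]$). -}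

module Defs where

open import Data.Nat using (ℕ)

Var : Set
Var = ℕ

data BTerm : Set where
  var  : Var → BTerm
  app  : BTerm → BTerm → BTerm
  lam  : Var → BTerm → BTerm
  bang : BTerm → BTerm
  der  : BTerm → BTerm
  esub : BTerm → Var → BTerm → BTerm   -- esub t x u  =  t[x\u]

data BCtx : Set where
  hole  : BCtx
  appL  : BCtx → BTerm → BCtx
  appR  : BTerm → BCtx → BCtx
  lam   : Var → BCtx → BCtx
  bang  : BCtx → BCtx
  der   : BCtx → BCtx
  esubL : BCtx → Var → BTerm → BCtx
  esubR : BTerm → Var → BCtx → BCtx

-- Bang surface contexts (hole not under a !)
data BSurface : BCtx → Set where
  hole  : BSurface hole
  appL  : ∀ {S t} → BSurface S → BSurface (appL S t)
  appR  : ∀ {t S} → BSurface S → BSurface (appR t S)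
  lam   : ∀ {x S} → BSurface S → BSurface (lam x S)
  der   : ∀ {S} → BSurface S → BSurface (der S)
  esubL : ∀ {S x t} → BSurface S → BSurface (esubL S x t)
  esubR : ∀ {t x S} → BSurface S → BSurface (esubR t x S)

data NTerm : Set where
  var  : Var → NTerm
  lam  : Var → NTerm → NTerm
  app  : NTerm → NTerm → NTerm
  esub : NTerm → Var → NTerm → NTerm

data NCtx : Set where
  hole  : NCtx
  appL  : NCtx → NTerm → NCtx
  appR  : NTerm → NCtx → NCtx
  lam   : Var → NCtx → NCtx
  esubL : NCtx → Var → NTerm → NCtx
  esubR : NTerm → Var → NCtx → NCtx

data NSurface : NCtx → Set where
  hole  : NSurface hole
  appL  : ∀ {N t} → NSurface N → NSurface (appL N t)
  lam   : ∀ {x N} → NSurface N → NSurface (lam x N)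
  esubL : ∀ {N x t} → NSurface N → NSurface (esubL N x t)

_ⁿ : NTerm → BTerm
var x ⁿ      = var x
lam x t ⁿ    = lam x (t ⁿ)
app t u ⁿ    = app (t ⁿ) (bang (u ⁿ))
esub t x u ⁿ = esub (t ⁿ) x (bang (u ⁿ))

_ᶜⁿ : NCtx → BCtx
hole ᶜⁿ        = hole
appL G t ᶜⁿ    = appL (G ᶜⁿ) (bang (t ⁿ))
appR t G ᶜⁿ    = appR (t ⁿ) (bang (G ᶜⁿ))
lam x G ᶜⁿ     = lam x (G ᶜⁿ)
esubL G x t ᶜⁿ = esubL (G ᶜⁿ) x (bang (t ⁿ))
esubR t x G ᶜⁿ = esubR (t ⁿ) x (bang (G ᶜⁿ))

module Submission where

open import Defs
open import Data.Product using (_×_; _,_)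
open import Relation.Binary.PropositionalEquality using (_≡_; refl)

NSurface⇒BSurface-ᶜⁿ : (N : NCtx) → NSurface N → BSurface (N ᶜⁿ)
NSurface⇒BSurface-ᶜⁿ hole          hole      = hole
NSurface⇒BSurface-ᶜⁿ (appL N t)    (appL s)  = appL (NSurface⇒BSurface-ᶜⁿ N s)
NSurface⇒BSurface-ᶜⁿ (lam x N)     (lam s)   = lam (NSurface⇒BSurface-ᶜⁿ N s)
NSurface⇒BSurface-ᶜⁿ (esubL N x t) (esubL s) = esubL (NSurface⇒BSurface-ᶜⁿ N s)

-- The embedding puts the hole of an argument or substituted context under a !,
-- so those two cases are refuted by BSurface having no bang constructor.
BSurface-ᶜⁿ⇒NSurface : (G : NCtx) → BSurface (G ᶜⁿ) → NSurface G
BSurface-ᶜⁿ⇒NSurface hole          _               = hole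
BSurface-ᶜⁿ⇒NSurface (appL G t)    (appL s)        = appL (BSurface-ᶜⁿ⇒NSurface G s)
BSurface-ᶜⁿ⇒NSurface (appR t G)    (appR ())
BSurface-ᶜⁿ⇒NSurface (lam x G)     (lam s)         = lam (BSurface-ᶜⁿ⇒NSurface G s)
BSurface-ᶜⁿ⇒NSurface (esubL G x t) (esubL s)       = esubL (BSurface-ᶜⁿ⇒NSurface G s)
BSurface-ᶜⁿ⇒NSurface (esubR t x G) (esubR ())

lemma4 : ((N : NCtx) → NSurface N → BSurface (N ᶜⁿ))
         × ((S : BCtx) (G : NCtx) → BSurface S → G ᶜⁿ ≡ S → NSurface G)
lemma4 = NSurface⇒BSurface-ᶜⁿ , λ { _ G s refl → BSurface-ᶜⁿ⇒NSurface G s }
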